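{- Let $a<b<c$ be natural numbers with $a+b>c$ and $a+b+c$ even. Then no avoidable subset of $\mathbb{N}$ (with respect to $(\mathbb{N},+)$) contains $\{a,b,c\}$.
   Context: For a set $S$ with a binary operation, a subset $U\subseteq S$ is avoidable if there is a partition $\{A,B\}$ of $S$ such that no element of $U$ is the product (here: sum) of two distinct elements of $A$ or of two distinct elements of $B$. Here $S=\mathbb{N}$ with ordinary addition. -}

module Defs where

open import Data.Nat using (ℕ; _+_; _≥_)
open import Data.Bool using (Bool)
open import Data.Product using (Σ; ∃; _×_)
open import Relation.Binary.PropositionalEquality using (_≡_; _≢_)
open import Relation.Nullary using (¬_)

-- Convention: ℕ = {1,2,3,...} (positive integers), represented by elements
-- n : Data.Nat.ℕ with n ≥ 1.  Subsets of ℕ are predicates.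
-- A partition {A,B} of ℕ is given by a colouring χ : ℕ → Bool
-- (A = χ⁻¹(true), B = χ⁻¹(false)) with both classes nonempty in ℕ≥1.

Subset : Set₁
Subset = ℕ → Set

IsPartition : (ℕ → Bool) → Set
IsPartition χ = (∃ λ x → x ≥ 1 × χ x ≡ Bool.true) × (∃ λ y → y ≥ 1 × χ y ≡ Bool.false)
  where import Data.Bool as Bool

AvoidsWith : Subset → (ℕ → Bool) → Set
AvoidsWith U χ = ∀ x y → x ≥ 1 → y ≥ 1 → x ≢ y → χ x ≡ χ y → ¬ U (x + y)

Avoidable : Subset → Set
Avoidable U = Σ (ℕ → Bool) λ χ → IsPartition χ × AvoidsWith U χ

{-# OPTIONS --safe #-}
module Submission where

open import Defs
open import Data.Nat using (ℕ; _+_; _<_)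
open import Data.Nat.Divisibility using (_∣_)
open import Data.Empty using (⊥)

open import Data.Bool using (Bool; true; false)
open import Data.List using (_∷_; [])
open import Data.Nat using (_*_; _∸_; _≤_; _≥_)
open import Data.Nat.Divisibility using (divides)
open import Data.Nat.Properties
open import Algebra.Properties.CommutativeSemigroup +-commutativeSemigroup using (interchange)
open import Data.Nat.Tactic.RingSolver using (solve)
open import Data.Product using (∃-syntax; _×_; _,_)
open import Data.Sum using (_⊎_; inj₁; inj₂)
open import Relation.Binary.PropositionalEquality
open import Relation.Nullary using (¬_)

-- A triangle with even perimeter 2k has sides x + y, x + z, y + z where x, y, z are
-- the differences between k and the sides.  These three numbers are positive and
-- distinct, so in any 2-colouring two of them share a colour and their sum, a side
-- of the triangle, is a sum of two distinct elements of one class.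

two-of-three-equal : {A : Set} (χ : A → Bool) (x y z : A) →
  χ x ≡ χ y ⊎ χ x ≡ χ z ⊎ χ y ≡ χ z
two-of-three-equal χ x y z with χ x | χ y | χ z
... | true  | true  | _     = inj₁ refl
... | false | false | _     = inj₁ refl
... | true  | false | true  = inj₂ (inj₁ refl)
... | false | true  | false = inj₂ (inj₁ refl)
... | true  | false | false = inj₂ (inj₂ refl)
... | false | true  | true  = inj₂ (inj₂ refl)

¬Avoidable-pairwiseSums : ∀ {x y z} → x ≥ 1 → y ≥ 1 → z ≥ 1 → x ≢ y → x ≢ z → y ≢ z →
  (U : Subset) → U (x + y) → U (x + z) → U (y + z) → ¬ Avoidable U
¬Avoidable-pairwiseSums x≥1 y≥1 z≥1 x≢y x≢z y≢z U x+y∈U x+z∈U y+z∈U (χ , _ , avoids)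
  with two-of-three-equal χ _ _ _
... | inj₁ χx≡χy        = avoids _ _ x≥1 y≥1 x≢y χx≡χy x+y∈U
... | inj₂ (inj₁ χx≡χz) = avoids _ _ x≥1 z≥1 x≢z χx≡χz x+z∈U
... | inj₂ (inj₂ χy≡χz) = avoids _ _ y≥1 z≥1 y≢z χy≡χz y+z∈U

m+m≡m*2 : ∀ m → m + m ≡ m * 2
m+m≡m*2 m = trans (cong (m +_) (sym (+-identityʳ m))) (*-comm 2 m)

m+m<n*2⇒m<n : ∀ {m n} → m + m < n * 2 → m < n
m+m<n*2⇒m<n {m} {n} m+m<n*2 = *-cancelʳ-< 2 m n (subst (_< n * 2) (m+m≡m*2 m) m+m<n*2)

[k∸p]+[k∸q]≡r : ∀ {k p q r} → p ≤ k → q ≤ k → p + q + r ≡ k * 2 → (k ∸ p) + (k ∸ q) ≡ r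
[k∸p]+[k∸q]≡r {k} {p} {q} {r} p≤k q≤k p+q+r≡k*2 = +-cancelʳ-≡ (p + q) _ _ (begin
  (k ∸ p) + (k ∸ q) + (p + q) ≡⟨ interchange (k ∸ p) (k ∸ q) p q ⟩
  (k ∸ p + p) + (k ∸ q + q)   ≡⟨ cong₂ _+_ (m∸n+n≡m p≤k) (m∸n+n≡m q≤k) ⟩
  k + k                       ≡⟨ m+m≡m*2 k ⟩
  k * 2                       ≡⟨ p+q+r≡k*2 ⟨
  p + q + r                   ≡⟨ +-comm (p + q) r ⟩
  r + (p + q)                 ∎)
  where open ≡-Reasoning

evenTriangle⇒pairwiseSums : ∀ {a b c} → a < b → b < c → c < a + b → 2 ∣ a + b + c →
  ∃[ x ] ∃[ y ] ∃[ z ] x ≥ 1 × x < y × y < z × x + y ≡ a × x + z ≡ b × y + z ≡ c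
evenTriangle⇒pairwiseSums {a} {b} {c} a<b b<c c<a+b (divides k a+b+c≡k*2) =
  k ∸ c , k ∸ b , k ∸ a ,
  m<n⇒0<n∸m c<k , ∸-monoʳ-< b<c c≤k , ∸-monoʳ-< a<b b≤k ,
  [k∸p]+[k∸q]≡r c≤k b≤k (trans c+b+a≡a+b+c a+b+c≡k*2) ,
  [k∸p]+[k∸q]≡r c≤k a≤k (trans c+a+b≡a+b+c a+b+c≡k*2) ,
  [k∸p]+[k∸q]≡r b≤k a≤k (trans b+a+c≡a+b+c a+b+c≡k*2)
  where
  c+b+a≡a+b+c : c + b + a ≡ a + b + c
  c+b+a≡a+b+c = solve (a ∷ b ∷ c ∷ [])
  c+a+b≡a+b+c : c + a + b ≡ a + b + c
  c+a+b≡a+b+c = solve (a ∷ b ∷ c ∷ [])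
  b+a+c≡a+b+c : b + a + c ≡ a + b + c
  b+a+c≡a+b+c = solve (a ∷ b ∷ c ∷ [])
  c<k : c < k
  c<k = m+m<n*2⇒m<n (subst (c + c <_) a+b+c≡k*2 (+-monoˡ-< c c<a+b))
  c≤k : c ≤ k
  c≤k = <⇒≤ c<k
  b≤k : b ≤ k
  b≤k = <⇒≤ (<-trans b<c c<k)
  a≤k : a ≤ k
  a≤k = <⇒≤ (<-trans a<b (<-trans b<c c<k))

mainTheorem15 : (a b c : ℕ) → a < b → b < c → c < a + b → 2 ∣ (a + b + c) →
    (U : Subset) → Avoidable U → U a → U b → U c → ⊥
mainTheorem15 a b c a<b b<c c<a+b 2∣a+b+c U avoidable a∈U b∈U c∈U
  with evenTriangle⇒pairwiseSums a<b b<c c<a+b 2∣a+b+c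
... | x , y , z , x≥1 , x<y , y<z , refl , refl , refl =
  ¬Avoidable-pairwiseSums x≥1 (<-trans x≥1 x<y) (<-trans (<-trans x≥1 x<y) y<z)
    (<⇒≢ x<y) (<⇒≢ (<-trans x<y y<z)) (<⇒≢ y<z) U a∈U b∈U c∈U avoidable
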